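{- Let $T$ be a tree, $e=(v_1,v_2)\in E^2(T)$, and let $T_1,T_2$ be the constituents of $T$ for $e$. Then \[|E_{fix}(T)| = |E_{fix}(T_1,v_1)|\,|E_{fix}(T_2,v_2)| + |E_{fix}(T_1)|\,|E_{fix}(T_2)|.\]
   Context: For a tree $T=(V,E)$, a set $F\subseteq E$ and a node $v$, $deg_F(v)$ is the number of edges of $F$ incident to $v$, and $deg(v)$ is the degree of $v$ in $T$. $E^2(T)$ is the set of edges of $T$ both of whose end nodes have degree at least $2$. $E_{fix}(T)$ is the set of all $F\subseteq E$ with $2deg_F(v)\le deg(v)$ for every $v\in V$. For a node $v$, $E_{fix}(T,v)=\{F\in E_{fix}(T) : 2(deg_F(v)+1)\le deg(v)\}$ (degrees taken in $T$). For an edge $e=(v_1,v_2)$, the constituent $T_i$ ($i=1,2$) is the subtree of $T$ consisting of the edge $e$ together with the connected component of $T\setminus e$ containing $v_i$. -}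

module Defs where

open import Data.Nat using (ℕ; suc; _+_; _*_; _≤_; _≥_; _≤?_)
open import Data.Fin using (Fin; _≟_)
open import Data.Fin.Properties using (all?)
open import Data.Fin.Subset using (Subset; _∈_; _⊆_; ⊤; inside; outside)
open import Data.Fin.Subset.Properties using (_∈?_; _⊆?_)
open import Data.Vec using ([]; _∷_)
open import Data.List using (List; []; _∷_; map; _++_; filter; length; allFin)
open import Data.Product using (_×_; _,_; proj₁; proj₂)
open import Data.Sum using (_⊎_)
open import Relation.Nullary using (¬_; Dec; _×-dec_; _⊎-dec_)
open import Relation.Binary.PropositionalEquality using (_≡_)

Graph : ℕ → ℕ → Set
Graph n m = Fin m → Fin n × Fin n

Incident : ∀ {n m} → Graph n m → Fin m → Fin n → Set
Incident G f v = proj₁ (G f) ≡ v ⊎ proj₂ (G f) ≡ v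

incident? : ∀ {n m} (G : Graph n m) f v → Dec (Incident G f v)
incident? G f v = (proj₁ (G f) ≟ v) ⊎-dec (proj₂ (G f) ≟ v)

Joins : ∀ {n m} → Graph n m → Fin m → Fin n → Fin n → Set
Joins G f u w = G f ≡ (u , w) ⊎ G f ≡ (w , u)

data Walk {n m} (G : Graph n m) (ok : Fin m → Set) : Fin n → Fin n → Set where
  stop : ∀ {u} → Walk G ok u u
  step : ∀ {u w x} (f : Fin m) → ok f → Joins G f u w → Walk G ok w x → Walk G ok u x

AnyEdge : ∀ {m} → Fin m → Set
AnyEdge _ = Data.Unit.⊤ where import Data.Unit

Connected : ∀ {n m} → Graph n m → Set
Connected G = ∀ u w → Walk G AnyEdge u w

IsTree : ∀ {n m} → Graph n m → Set
IsTree {n} {m} G = Connected G × n ≡ suc m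

deg : ∀ {n m} → Graph n m → Subset m → Fin n → ℕ
deg {m = m} G S v = length (filter (λ f → (f ∈? S) ×-dec incident? G f v) (allFin m))

subsets : ∀ m → List (Subset m)
subsets Data.Nat.zero = [] ∷ []
subsets (suc m) = map (outside ∷_) (subsets m) ++ map (inside ∷_) (subsets m)

-- F ∈ E_fix(S) for the (sub)tree with edge set S (degrees taken in S)
Fix : ∀ {n m} → Graph n m → Subset m → Subset m → Set
Fix G S F = F ⊆ S × (∀ v → 2 * deg G F v ≤ deg G S v)

fix? : ∀ {n m} (G : Graph n m) S F → Dec (Fix G S F)
fix? G S F = (F ⊆? S) ×-dec all? (λ v → 2 * deg G F v ≤? deg G S v)

FixAt : ∀ {n m} → Graph n m → Subset m → Fin n → Subset m → Set
FixAt G S v F = Fix G S F × 2 * (deg G F v + 1) ≤ deg G S v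

fixAt? : ∀ {n m} (G : Graph n m) S v F → Dec (FixAt G S v F)
fixAt? G S v F = fix? G S F ×-dec (2 * (deg G F v + 1) ≤? deg G S v)

#Efix : ∀ {n m} → Graph n m → Subset m → ℕ
#Efix {m = m} G S = length (filter (fix? G S) (subsets m))

#EfixAt : ∀ {n m} → Graph n m → Subset m → Fin n → ℕ
#EfixAt {m = m} G S v = length (filter (fixAt? G S v) (subsets m))

-- S is the edge set of the constituent of G for edge e containing v:
-- e together with the component of G ∖ e containing v
-- (an edge f ≠ e lies in that component iff an end of it is reachable
-- from v without using e).
IsConstituent : ∀ {n m} → Graph n m → Fin m → Fin n → Subset m → Set
IsConstituent G e v S =
  ∀ f → (f ∈ S → (f ≡ e ⊎ (¬ f ≡ e × Walk G (λ g → ¬ g ≡ e) v (proj₁ (G f)))))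
      × ((f ≡ e ⊎ (¬ f ≡ e × Walk G (λ g → ¬ g ≡ e) v (proj₁ (G f)))) → f ∈ S)

{-# OPTIONS --safe #-}
-- Let A and B be the edges of T₁ and T₂ other than e. Removing e from a tree
-- separates v₁ from v₂, so every vertex has all its edges in T₁ or all in T₂,
-- and the condition 2 deg_F(u) ≤ deg(u) splits into a condition on F ∩ A in T₁
-- and one on F ∩ B in T₂. Only v₁ and v₂ see e: if e ∉ F the two conditions say
-- F ∩ A ∈ E_fix(T₁) and F ∩ B ∈ E_fix(T₂); if e ∈ F the extra edge at vᵢ turns
-- them into F ∩ A ∈ E_fix(T₁,v₁) and F ∩ B ∈ E_fix(T₂,v₂). As v₂ is a leaf of
-- T₁, no set in E_fix(T₁) contains e (likewise for T₂), so counting subsets of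
-- E block by block over A, {e}, B yields the two products.
module Submission where

open import Defs
open import Data.Bool using (true)
open import Data.Empty using (⊥-elim)
open import Data.Fin as Fin using (Fin; zero; suc; punchIn; punchOut)
open import Data.Fin.Properties using (punchOut-cong; punchOut-punchIn; punchInᵢ≢i; punchIn-punchOut)
open import Data.Fin.Subset using (Subset; _∈_; _∉_; _⊆_; _∩_; ⊤; inside; outside)
open import Data.Fin.Subset.Properties using (_∈?_; _⊆?_; out⊆-⇔; in⊆in-⇔; ∈⊤; ∉⊥; ⊥⊆; ⊆-refl; ⊆-antisym; x∈p∩q⁺; x∈p∩q⁻)
open import Data.List using (List; []; _∷_; map; _++_; filter; length; allFin)
open import Data.List.Membership.Propositional using (lose) renaming (_∈_ to _∈ˡ_)
open import Data.List.Membership.Propositional.Properties using (∈-allFin)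
open import Data.List.Properties using (filter-++; length-++; filter-≐; filter-accept; filter-reject; filter-none; filter-some)
open import Data.List.Relation.Unary.All as All using ()
open import Data.List.Relation.Unary.AllPairs using (_∷_)
open import Data.List.Relation.Unary.Any using (here; there)
open import Data.List.Relation.Unary.Unique.Propositional using (Unique)
open import Data.List.Relation.Unary.Unique.Propositional.Properties using (allFin⁺)
open import Data.Nat using (ℕ; zero; suc; _+_; _*_; _≤_; _≥_; _<_; z≤n; s≤s)
open import Data.Nat.Properties using (module ≤-Reasoning; m≤m+n; n≤1+n; +-suc; +-comm; +-identityʳ; *-identityʳ; *-distribʳ-+; *-distribˡ-+; *-monoʳ-≤; ≤-trans; <-irrefl)
open import Data.Product as Product using (_×_; _,_; proj₁; proj₂; ∃-syntax)
open import Data.Sum as Sum using (_⊎_; inj₁; inj₂)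
open import Data.Unit using (tt)
open import Data.Vec as Vec using (Vec; []; _∷_; here; lookup)
open import Data.Vec.Properties using (∷-injective; lookup-map; lookup∘tabulate; []=⇒lookup; lookup⇒[]=)
open import Function using (_∘_; id; case_of_; Equivalence)
open import Relation.Binary.Definitions using (DecidableEquality)
open import Relation.Binary.PropositionalEquality
open import Relation.Nullary using (¬_; yes; no; ¬?; _×-dec_)
open import Relation.Nullary.Decidable using (Dec; does; dec-true)
open import Relation.Unary using (Decidable; _≐_)

open Equivalence using (to; from)

count : {A : Set} {P : A → Set} → Decidable P → List A → ℕ
count P? xs = length (filter P? xs)

module _ {A : Set} {P : A → Set} (P? : Decidable P) where

  count-++ : ∀ xs ys → count P? (xs ++ ys) ≡ count P? xs + count P? ys
  count-++ xs ys = trans (cong length (filter-++ P? xs ys)) (length-++ (filter P? xs))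

  count-map : {B : Set} (f : B → A) → ∀ xs → count P? (map f xs) ≡ count (P? ∘ f) xs
  count-map f [] = refl
  count-map f (x ∷ xs) with P? (f x)
  ... | yes _ = cong suc (count-map f xs)
  ... | no _  = count-map f xs

  count-split : {Q : A → Set} (Q? : Decidable Q) → ∀ xs →
    count P? xs ≡ count (λ x → P? x ×-dec Q? x) xs + count (λ x → P? x ×-dec ¬? (Q? x)) xs
  count-split Q? [] = refl
  count-split Q? (x ∷ xs) with P? x | Q? x
  ... | yes _ | yes _ = cong suc (count-split Q? xs)
  ... | yes _ | no _  = trans (cong suc (count-split Q? xs)) (sym (+-suc _ _))
  ... | no _  | yes _ = count-split Q? xs
  ... | no _  | no _  = count-split Q? xs

count-≐ : {A : Set} {P Q : A → Set} (P? : Decidable P) (Q? : Decidable Q) →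
  P ≐ Q → ∀ xs → count P? xs ≡ count Q? xs
count-≐ P? Q? P≐Q xs = cong length (filter-≐ P? Q? P≐Q xs)

count-mono : {A : Set} {P Q : A → Set} (P? : Decidable P) (Q? : Decidable Q) →
  (∀ {x} → P x → Q x) → ∀ xs → count P? xs ≤ count Q? xs
count-mono P? Q? P⇒Q xs = begin
  count P? xs
    ≡⟨ count-≐ P? (λ x → Q? x ×-dec P? x) ((λ p → P⇒Q p , p) , proj₂) xs ⟩
  count (λ x → Q? x ×-dec P? x) xs
    ≤⟨ m≤m+n _ _ ⟩
  count (λ x → Q? x ×-dec P? x) xs + count (λ x → Q? x ×-dec ¬? (P? x)) xs
    ≡⟨ count-split Q? P? xs ⟨
  count Q? xs ∎
  where open ≤-Reasoning

module _ {A : Set} (_≟_ : DecidableEquality A) where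

  count-≟-unique : ∀ {x xs} → Unique xs → x ∈ˡ xs → count (_≟ x) xs ≡ 1
  count-≟-unique {x} {_ ∷ xs} (x≢xs ∷ _) (here refl) = begin
    count (_≟ x) (x ∷ xs) ≡⟨ cong length (filter-accept (_≟ x) refl) ⟩
    suc (count (_≟ x) xs) ≡⟨ cong (suc ∘ length) (filter-none (_≟ x) (All.map (_∘ sym) x≢xs)) ⟩
    1                     ∎
    where open ≡-Reasoning
  count-≟-unique {x} {y ∷ xs} (y≢xs ∷ unique) (there x∈xs) =
    trans (cong length (filter-reject (_≟ x) (All.lookup y≢xs x∈xs)))
          (count-≟-unique unique x∈xs)

#subsets : ∀ {m} {P : Subset m → Set} → Decidable P → ℕ
#subsets {m} P? = count P? (subsets m)

module _ {m} {P : Subset (suc m) → Set} (P? : Decidable P) where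

  #subsets-suc : #subsets P? ≡ #subsets (P? ∘ (outside ∷_)) + #subsets (P? ∘ (inside ∷_))
  #subsets-suc = trans (count-++ P? (map (outside ∷_) (subsets m)) (map (inside ∷_) (subsets m)))
    (cong₂ _+_ (count-map P? (outside ∷_) (subsets m)) (count-map P? (inside ∷_) (subsets m)))

#subsets-none : ∀ {m} {P : Subset m → Set} (P? : Decidable P) → (∀ {X} → ¬ P X) → #subsets P? ≡ 0
#subsets-none {m} P? ¬P = cong length (filter-none P? (All.universal (λ _ → ¬P) (subsets m)))

#subsets-unique : ∀ {m} {P : Subset m → Set} (P? : Decidable P) {W} →
  P W → (∀ {X} → P X → X ≡ W) → #subsets P? ≡ 1
#subsets-unique {zero} P? {[]} pW _ = cong length (filter-accept P? pW)
#subsets-unique {suc m} P? {outside ∷ W} pW only = trans (#subsets-suc P?) (cong₂ _+_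
  (#subsets-unique (P? ∘ (outside ∷_)) pW (proj₂ ∘ ∷-injective ∘ only))
  (#subsets-none (P? ∘ (inside ∷_)) (λ p → case (proj₁ (∷-injective (only p))) of λ ())))
#subsets-unique {suc m} P? {inside ∷ W} pW only = trans (#subsets-suc P?) (cong₂ _+_
  (#subsets-none (P? ∘ (outside ∷_)) (λ p → case (proj₁ (∷-injective (only p))) of λ ()))
  (#subsets-unique (P? ∘ (inside ∷_)) pW (proj₂ ∘ ∷-injective ∘ only)))

#subsetsOf : ∀ {m} (S : Subset m) {P : Subset m → Set} → Decidable P → ℕ
#subsetsOf S P? = #subsets (λ X → X ⊆? S ×-dec P? X)

module _ {m} (S : Subset m) {P : Subset (suc m) → Set} (P? : Decidable P) where

  #subsetsOf-inside : #subsetsOf (inside ∷ S) P? ≡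
    #subsetsOf S (P? ∘ (outside ∷_)) + #subsetsOf S (P? ∘ (inside ∷_))
  #subsetsOf-inside = trans (#subsets-suc (λ X → X ⊆? inside ∷ S ×-dec P? X)) (cong₂ _+_
    (count-≐ _ _ (Product.map₁ (from out⊆-⇔) , Product.map₁ (to out⊆-⇔)) (subsets m))
    (count-≐ _ _ (Product.map₁ (from in⊆in-⇔) , Product.map₁ (to in⊆in-⇔)) (subsets m)))

  #subsetsOf-outside : #subsetsOf (outside ∷ S) P? ≡ #subsetsOf S (P? ∘ (outside ∷_))
  #subsetsOf-outside = trans (#subsets-suc (λ X → X ⊆? outside ∷ S ×-dec P? X)) (trans (cong₂ _+_
    (count-≐ _ _ (Product.map₁ (from out⊆-⇔) , Product.map₁ (to out⊆-⇔)) (subsets m))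
    (#subsets-none (λ X → inside ∷ X ⊆? outside ∷ S ×-dec P? (inside ∷ X))
                   (λ (X⊆S , _) → case X⊆S here of λ ())))
    (+-identityʳ _))

Block : Set
Block = Fin 3

pattern left   = zero
pattern middle = suc zero
pattern right  = suc (suc zero)

block : ∀ {m} → Block → Vec Block m → Subset m
block b = Vec.map (λ x → does (x Fin.≟ b))

module _ {m} (c : Vec Block m) {b : Block} {i : Fin m} where

  ∈-block⁻ : i ∈ block b c → lookup c i ≡ b
  ∈-block⁻ i∈ = witness (lookup c i Fin.≟ b)
    (trans (sym (lookup-map i (λ x → does (x Fin.≟ b)) c)) ([]=⇒lookup i∈))
    where
    witness : ∀ {A : Set} (A? : Dec A) → does A? ≡ true → A
    witness (yes a) _ = a

  ∈-block⁺ : lookup c i ≡ b → i ∈ block b c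
  ∈-block⁺ ci≡b = lookup⇒[]= i (block b c)
    (trans (lookup-map i (λ x → does (x Fin.≟ b)) c) (dec-true (lookup c i Fin.≟ b) ci≡b))

module _ {m} {P : Subset (suc m) → Set} where

  out? : Decidable P → Decidable (P ∘ (outside ∷_))
  out? P? = P? ∘ (outside ∷_)

  in? : Decidable P → Decidable (P ∘ (inside ∷_))
  in? P? = P? ∘ (inside ∷_)

blockwise : ∀ {m} (c : Vec Block m) {P Q R : Subset m → Set} →
  Decidable P → Decidable Q → Decidable R →
  Decidable (λ F → P (F ∩ block left c) × Q (F ∩ block middle c) × R (F ∩ block right c))
blockwise c P? Q? R? F = P? (F ∩ block left c) ×-dec (Q? (F ∩ block middle c) ×-dec R? (F ∩ block right c))

#subsets-blocks : ∀ {m} (c : Vec Block m) {P Q R : Subset m → Set}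
  (P? : Decidable P) (Q? : Decidable Q) (R? : Decidable R) →
  #subsets (blockwise c P? Q? R?)
    ≡ #subsetsOf (block left c) P? * #subsetsOf (block middle c) Q? * #subsetsOf (block right c) R?
#subsets-blocks [] P? Q? R? with P? [] | Q? [] | R? []
... | yes _ | yes _ | yes _ = refl
... | yes _ | yes _ | no _  = refl
... | yes _ | no _  | yes _ = refl
... | yes _ | no _  | no _  = refl
... | no _  | yes _ | yes _ = refl
... | no _  | yes _ | no _  = refl
... | no _  | no _  | yes _ = refl
... | no _  | no _  | no _  = refl
#subsets-blocks (left ∷ c) P? Q? R? = begin
  #subsets (blockwise (left ∷ c) P? Q? R?)
    ≡⟨ #subsets-suc (blockwise (left ∷ c) P? Q? R?) ⟩
  #subsets (blockwise c (out? P?) (out? Q?) (out? R?)) + #subsets (blockwise c (in? P?) (out? Q?) (out? R?))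
    ≡⟨ cong₂ _+_ (#subsets-blocks c (out? P?) (out? Q?) (out? R?)) (#subsets-blocks c (in? P?) (out? Q?) (out? R?)) ⟩
  p₀ * q * r + p₁ * q * r
    ≡⟨ trans (sym (*-distribʳ-+ r (p₀ * q) (p₁ * q))) (cong (_* r) (sym (*-distribʳ-+ q p₀ p₁))) ⟩
  (p₀ + p₁) * q * r
    ≡⟨ cong₂ _*_ (cong₂ _*_ (#subsetsOf-inside A P?) (#subsetsOf-outside M Q?)) (#subsetsOf-outside R R?) ⟨
  _ ∎
  where
  open ≡-Reasoning
  A = block left c ; M = block middle c ; R = block right c
  p₀ = #subsetsOf A (out? P?) ; p₁ = #subsetsOf A (in? P?)
  q = #subsetsOf M (out? Q?) ; r = #subsetsOf R (out? R?)
#subsets-blocks (middle ∷ c) P? Q? R? = begin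
  #subsets (blockwise (middle ∷ c) P? Q? R?)
    ≡⟨ #subsets-suc (blockwise (middle ∷ c) P? Q? R?) ⟩
  #subsets (blockwise c (out? P?) (out? Q?) (out? R?)) + #subsets (blockwise c (out? P?) (in? Q?) (out? R?))
    ≡⟨ cong₂ _+_ (#subsets-blocks c (out? P?) (out? Q?) (out? R?)) (#subsets-blocks c (out? P?) (in? Q?) (out? R?)) ⟩
  p * q₀ * r + p * q₁ * r
    ≡⟨ trans (sym (*-distribʳ-+ r (p * q₀) (p * q₁))) (cong (_* r) (sym (*-distribˡ-+ p q₀ q₁))) ⟩
  p * (q₀ + q₁) * r
    ≡⟨ cong₂ _*_ (cong₂ _*_ (#subsetsOf-outside A P?) (#subsetsOf-inside M Q?)) (#subsetsOf-outside R R?) ⟨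
  _ ∎
  where
  open ≡-Reasoning
  A = block left c ; M = block middle c ; R = block right c
  p = #subsetsOf A (out? P?) ; q₀ = #subsetsOf M (out? Q?) ; q₁ = #subsetsOf M (in? Q?)
  r = #subsetsOf R (out? R?)
#subsets-blocks (right ∷ c) P? Q? R? = begin
  #subsets (blockwise (right ∷ c) P? Q? R?)
    ≡⟨ #subsets-suc (blockwise (right ∷ c) P? Q? R?) ⟩
  #subsets (blockwise c (out? P?) (out? Q?) (out? R?)) + #subsets (blockwise c (out? P?) (out? Q?) (in? R?))
    ≡⟨ cong₂ _+_ (#subsets-blocks c (out? P?) (out? Q?) (out? R?)) (#subsets-blocks c (out? P?) (out? Q?) (in? R?)) ⟩
  p * q * r₀ + p * q * r₁
    ≡⟨ *-distribˡ-+ (p * q) r₀ r₁ ⟨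
  p * q * (r₀ + r₁)
    ≡⟨ cong₂ _*_ (cong₂ _*_ (#subsetsOf-outside A P?) (#subsetsOf-outside M Q?)) (#subsetsOf-inside R R?) ⟨
  _ ∎
  where
  open ≡-Reasoning
  A = block left c ; M = block middle c ; R = block right c
  p = #subsetsOf A (out? P?) ; q = #subsetsOf M (out? Q?)
  r₀ = #subsetsOf R (out? R?) ; r₁ = #subsetsOf R (in? R?)

count-allFin-singleton : ∀ {m} {P : Fin m → Set} (P? : Decidable P) (e : Fin m) →
  (∀ {f} → P f → f ≡ e) → P e → count P? (allFin m) ≡ 1
count-allFin-singleton {m} P? e only pe =
  trans (count-≐ P? (Fin._≟ e) (only , λ { refl → pe }) (allFin m))
        (count-≟-unique Fin._≟_ (allFin⁺ m) (∈-allFin e))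

module _ {n m} (G : Graph n m) {v : Fin n} where

  private
    at : ∀ S → Decidable (λ f → f ∈ S × Incident G f v)
    at S f = f ∈? S ×-dec incident? G f v

  deg-cong : ∀ {S S′} → (∀ {f} → Incident G f v → f ∈ S → f ∈ S′) →
    (∀ {f} → Incident G f v → f ∈ S′ → f ∈ S) → deg G S v ≡ deg G S′ v
  deg-cong S⇒S′ S′⇒S = count-≐ (at _) (at _)
    ((λ (f∈ , i) → S⇒S′ i f∈ , i) , (λ (f∈ , i) → S′⇒S i f∈ , i)) (allFin m)

  deg-mono : ∀ {S S′} → (∀ {f} → Incident G f v → f ∈ S → f ∈ S′) → deg G S v ≤ deg G S′ v
  deg-mono S⇒S′ = count-mono (at _) (at _) (λ (f∈ , i) → S⇒S′ i f∈ , i) (allFin m)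

  deg-zero : ∀ {S} → (∀ {f} → Incident G f v → f ∉ S) → deg G S v ≡ 0
  deg-zero none = cong length (filter-none (at _) (All.universal (λ _ (f∈ , i) → none i f∈) (allFin m)))

  deg-pos : ∀ {S f} → f ∈ S → Incident G f v → 0 < deg G S v
  deg-pos {f = f} f∈ i = filter-some (at _) (lose (∈-allFin f) (f∈ , i))

  deg-one : ∀ {S} e → e ∈ S → Incident G e v → (∀ {f} → Incident G f v → f ∈ S → f ≡ e) →
    deg G S v ≡ 1
  deg-one e e∈ i only = count-allFin-singleton (at _) e (λ (f∈ , j) → only j f∈) (e∈ , i)

  deg-suc : ∀ {S S′} e → e ∈ S → Incident G e v → e ∉ S′ →
    (∀ {f} → Incident G f v → ¬ f ≡ e → f ∈ S → f ∈ S′) →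
    (∀ {f} → Incident G f v → f ∈ S′ → f ∈ S) → deg G S v ≡ suc (deg G S′ v)
  deg-suc {S} {S′} e e∈ i e∉ S⇒S′ S′⇒S = begin
    deg G S v
      ≡⟨ count-split (at S) (Fin._≟ e) (allFin m) ⟩
    count (λ f → at S f ×-dec (f Fin.≟ e)) (allFin m) + count (λ f → at S f ×-dec ¬? (f Fin.≟ e)) (allFin m)
      ≡⟨ cong₂ _+_ (count-allFin-singleton _ e proj₂ ((e∈ , i) , refl))
                   (count-≐ _ (at S′) (narrow , widen) (allFin m)) ⟩
    suc (deg G S′ v) ∎
    where
    open ≡-Reasoning
    narrow : ∀ {f} → (f ∈ S × Incident G f v) × ¬ f ≡ e → f ∈ S′ × Incident G f v
    narrow ((f∈ , j) , f≢e) = S⇒S′ j f≢e f∈ , j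
    widen : ∀ {f} → f ∈ S′ × Incident G f v → (f ∈ S × Incident G f v) × ¬ f ≡ e
    widen (f∈ , j) = (S′⇒S j f∈ , j) , λ { refl → e∉ f∈ }

module _ {n m} {G : Graph n m} {ok : Fin m → Set} where

  joins-sym : ∀ {f u w} → Joins G f u w → Joins G f w u
  joins-sym (inj₁ eq) = inj₂ eq
  joins-sym (inj₂ eq) = inj₁ eq

  _++ʷ_ : ∀ {u w x} → Walk G ok u w → Walk G ok w x → Walk G ok u x
  stop             ++ʷ q = q
  step f okf j p ++ʷ q = step f okf j (p ++ʷ q)

  reverseʷ : ∀ {u w} → Walk G ok u w → Walk G ok w u
  reverseʷ stop             = stop
  reverseʷ (step f okf j p) = reverseʷ p ++ʷ step f okf (joins-sym j) stop

MapsEdge : ∀ {n n′ m m′} → (Fin n → Fin n′) → Graph n m → Graph n′ m′ → (Fin m′ → Set) → Fin m → Set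
MapsEdge φ G G′ ok′ f =
  φ (proj₁ (G f)) ≡ φ (proj₂ (G f)) ⊎ ∃[ f′ ] ok′ f′ × G′ f′ ≡ Product.map φ φ (G f)

walk-map : ∀ {n n′ m m′} {G : Graph n m} {G′ : Graph n′ m′} {ok : Fin m → Set} {ok′ : Fin m′ → Set}
  (φ : Fin n → Fin n′) → (∀ {f} → ok f → MapsEdge φ G G′ ok′ f) →
  ∀ {u w} → Walk G ok u w → Walk G′ ok′ (φ u) (φ w)
walk-map φ edge stop = stop
walk-map {G = G} {G′} {ok′ = ok′} φ edge {w = w} (step {u} {x} f okf j p) with edge okf
... | inj₁ glued = subst (λ y → Walk G′ ok′ y (φ w)) (endpoints-glued j) (walk-map φ edge p)
  where
  endpoints-glued : Joins G f u x → φ x ≡ φ u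
  endpoints-glued (inj₁ eq) = sym (subst (λ e → φ (proj₁ e) ≡ φ (proj₂ e)) eq glued)
  endpoints-glued (inj₂ eq) = subst (λ e → φ (proj₁ e) ≡ φ (proj₂ e)) eq glued
... | inj₂ (f′ , okf′ , eq) = step f′ okf′ (image j) (walk-map φ edge p)
  where
  image : Joins G f u x → Joins G′ f′ (φ u) (φ x)
  image (inj₁ j) = inj₁ (trans eq (cong (Product.map φ φ) j))
  image (inj₂ j) = inj₂ (trans eq (cong (Product.map φ φ) j))

module _ {n} {a b : Fin (suc n)} (a≢b : ¬ a ≡ b) where

  merge : Fin (suc n) → Fin n
  merge x with x Fin.≟ b
  ... | yes _   = punchOut (a≢b ∘ sym)
  ... | no x≢b  = punchOut (x≢b ∘ sym)

  merge-glues : merge a ≡ merge b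
  merge-glues with a Fin.≟ b | b Fin.≟ b
  ... | yes a≡b | _      = ⊥-elim (a≢b a≡b)
  ... | no _    | yes _  = punchOut-cong b refl
  ... | no _    | no b≢b = ⊥-elim (b≢b refl)

  merge-punchIn : ∀ y → merge (punchIn b y) ≡ y
  merge-punchIn y with punchIn b y Fin.≟ b
  ... | yes eq = ⊥-elim (punchInᵢ≢i b y eq)
  ... | no _   = trans (punchOut-cong b refl) (punchOut-punchIn b)

connected⇒n≤1+m : ∀ {n m} (G : Graph n m) → Connected G → n ≤ suc m
connected⇒n≤1+m {zero}        {zero}  G conn = z≤n
connected⇒n≤1+m {suc zero}    {zero}  G conn = s≤s z≤n
connected⇒n≤1+m {suc (suc n)} {zero}  G conn with conn zero (suc zero)
... | step () _ _ _
connected⇒n≤1+m {zero}        {suc m} G conn with G zero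
... | () , _
connected⇒n≤1+m {suc n}       {suc m} G conn with proj₁ (G zero) Fin.≟ proj₂ (G zero)
... | yes loop = ≤-trans (connected⇒n≤1+m (G ∘ suc) (λ u w → walk-map id drop (conn u w))) (n≤1+n _)
  where
  drop : ∀ {f} → AnyEdge f → MapsEdge id G (G ∘ suc) AnyEdge f
  drop {zero}  _ = inj₁ loop
  drop {suc f} _ = inj₂ (f , tt , refl)
... | no a≢b = s≤s (connected⇒n≤1+m G/e conn/e)
  where
  G/e : Graph n m
  G/e = Product.map (merge a≢b) (merge a≢b) ∘ G ∘ suc
  contract : ∀ {f} → AnyEdge f → MapsEdge (merge a≢b) G G/e AnyEdge f
  contract {zero}  _ = inj₁ (merge-glues a≢b)
  contract {suc f} _ = inj₂ (f , tt , refl)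
  conn/e : Connected G/e
  conn/e u w = subst₂ (Walk G/e AnyEdge) (merge-punchIn a≢b u) (merge-punchIn a≢b w)
    (walk-map (merge a≢b) contract (conn (punchIn (proj₂ (G zero)) u) (punchIn (proj₂ (G zero)) w)))

StarIn : ∀ {n m} → Graph n m → Subset m → Fin n → Set
StarIn G S u = ∀ {f} → Incident G f u → f ∈ S

Avoiding : ∀ {n m} → Graph n m → Fin m → Fin n → Fin n → Set
Avoiding G e = Walk G (λ f → ¬ f ≡ e)

avoiding⇒star : ∀ {n m} {T : Graph n m} {e v S u} → IsConstituent T e v S →
  Avoiding T e v u → StarIn T S u
avoiding⇒star {T = T} {e} C walk {f} i with f Fin.≟ e
... | yes refl = proj₂ (C e) (inj₁ refl)
avoiding⇒star {T = T} {e} C walk {f} (inj₁ src) | no f≢e =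
  proj₂ (C f) (inj₂ (f≢e , subst (Avoiding T e _) (sym src) walk))
avoiding⇒star {T = T} {e} C walk {f} (inj₂ tgt) | no f≢e =
  proj₂ (C f) (inj₂ (f≢e , walk ++ʷ step f f≢e (inj₂ (cong (proj₁ (T f) ,_) tgt)) stop))

tree-edge-disconnects : ∀ {n m} {T : Graph n m} → IsTree T → (e : Fin m) →
  ¬ (∀ u w → Avoiding T e u w)
tree-edge-disconnects {m = suc m} {T} tree e avoid =
  <-irrefl refl (subst (_≤ suc m) (proj₂ tree) (connected⇒n≤1+m (T ∘ punchIn e) conn))
  where
  keep : ∀ {f} → ¬ f ≡ e → MapsEdge id T (T ∘ punchIn e) AnyEdge f
  keep f≢e = inj₂ (punchOut (f≢e ∘ sym) , tt , cong T (punchIn-punchOut (f≢e ∘ sym)))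
  conn : Connected (T ∘ punchIn e)
  conn u w = walk-map id keep (avoid u w)

module _ {n m} {T : Graph n m} (tree : IsTree T) {e v₁ v₂} (Te : T e ≡ (v₁ , v₂)) where

  last-crossing : ∀ {u x} → Walk T AnyEdge u x → Avoiding T e u x ⊎ Avoiding T e v₁ x ⊎ Avoiding T e v₂ x
  last-crossing stop = inj₁ stop
  last-crossing (step f _ j p) with last-crossing p | f Fin.≟ e
  ... | inj₂ tail | _        = inj₂ tail
  ... | inj₁ tail | no f≢e   = inj₁ (step f f≢e j tail)
  last-crossing (step f _ (inj₁ j) p) | inj₁ tail | yes refl =
    inj₂ (inj₂ (subst (λ y → Avoiding T e y _) (trans (sym (cong proj₂ j)) (cong proj₂ Te)) tail))
  last-crossing (step f _ (inj₂ j) p) | inj₁ tail | yes refl =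
    inj₂ (inj₁ (subst (λ y → Avoiding T e y _) (trans (sym (cong proj₁ j)) (cong proj₁ Te)) tail))

  reaches-an-end : ∀ x → Avoiding T e v₁ x ⊎ Avoiding T e v₂ x
  reaches-an-end x = Sum.[ inj₁ , id ] (last-crossing (proj₁ tree v₁ x))

  ends-separated : ¬ Avoiding T e v₁ v₂
  ends-separated v₁→v₂ = tree-edge-disconnects tree e (λ u w → reverseʷ (from-v₁ u) ++ʷ from-v₁ w)
    where
    from-v₁ : ∀ x → Avoiding T e v₁ x
    from-v₁ x = Sum.[ id , v₁→v₂ ++ʷ_ ] (reaches-an-end x)

record EdgeSplit {n m} (T : Graph n m) (e : Fin m) (v₁ v₂ : Fin n) (T₁ T₂ : Subset m) : Set where
  field
    e-at₁       : Incident T e v₁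
    e-at₂       : Incident T e v₂
    e-ends      : ∀ {u} → Incident T e u → u ≡ v₁ ⊎ u ≡ v₂
    star₁       : StarIn T T₁ v₁
    star₂       : StarIn T T₂ v₂
    common-edge : ∀ {f} → f ∈ T₁ → f ∈ T₂ → f ≡ e
    sides       : ∀ u → StarIn T T₁ u ⊎ StarIn T T₂ u

  cover : ∀ f → f ∈ T₁ ⊎ f ∈ T₂
  cover f = Sum.map (λ s → s (inj₁ refl)) (λ s → s (inj₁ refl)) (sides (proj₁ (T f)))

  swap : EdgeSplit T e v₂ v₁ T₂ T₁
  swap = record
    { e-at₁ = e-at₂ ; e-at₂ = e-at₁ ; e-ends = Sum.swap ∘ e-ends
    ; star₁ = star₂ ; star₂ = star₁ ; common-edge = λ f∈T₂ f∈T₁ → common-edge f∈T₁ f∈T₂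
    ; sides = Sum.swap ∘ sides
    }

constituents-split : ∀ {n m} {T : Graph n m} → IsTree T → ∀ {e v₁ v₂} → T e ≡ (v₁ , v₂) →
  ∀ {T₁ T₂} → IsConstituent T e v₁ T₁ → IsConstituent T e v₂ T₂ → EdgeSplit T e v₁ v₂ T₁ T₂
constituents-split {T = T} tree {e} Te C₁ C₂ = record
  { e-at₁       = inj₁ (cong proj₁ Te)
  ; e-at₂       = inj₂ (cong proj₂ Te)
  ; e-ends      = Sum.map (λ eq → trans (sym eq) (cong proj₁ Te)) (λ eq → trans (sym eq) (cong proj₂ Te))
  ; star₁       = avoiding⇒star C₁ stop
  ; star₂       = avoiding⇒star C₂ stop
  ; common-edge = common-edge
  ; sides       = Sum.map (avoiding⇒star C₁) (avoiding⇒star C₂) ∘ reaches-an-end tree Te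
  }
  where
  common-edge : ∀ {f} → f ∈ _ → f ∈ _ → f ≡ e
  common-edge {f} f∈T₁ f∈T₂ with proj₁ (C₁ f) f∈T₁ | proj₁ (C₂ f) f∈T₂
  ... | inj₁ f≡e      | _             = f≡e
  ... | inj₂ _        | inj₁ f≡e      = f≡e
  ... | inj₂ (_ , p₁) | inj₂ (_ , p₂) = ⊥-elim (ends-separated tree Te (p₁ ++ʷ reverseʷ p₂))

module Side {n m} {T : Graph n m} {e v v′ S S′} (split : EdgeSplit T e v v′ S S′) {A : Subset m}
  (A⁻ : ∀ {f} → f ∈ A → f ∈ S × ¬ f ≡ e) (A⁺ : ∀ {f} → f ∈ S → ¬ f ≡ e → f ∈ A) where

  open EdgeSplit split

  private
    ∩A⁻ : ∀ {F f} → f ∈ F ∩ A → f ∈ F × f ∈ S × ¬ f ≡ e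
    ∩A⁻ {F} f∈ = let (f∈F , f∈A) = x∈p∩q⁻ F A f∈ in f∈F , A⁻ f∈A

  leaf : deg T S v′ ≡ 1
  leaf = deg-one T e (star₁ e-at₁) e-at₂ (λ i f∈S → common-edge f∈S (star₂ i))

  fix⇒⊆ : ∀ {X} → Fix T S X → X ⊆ A
  fix⇒⊆ {X} (X⊆S , bound) {f} f∈X = A⁺ (X⊆S f∈X) f≢e
    where
    -- v′ is a leaf of S, so 2 * deg T X v′ ≤ 1 and no edge of X reaches v′.
    f≢e : ¬ f ≡ e
    f≢e refl with ≤-trans (*-monoʳ-≤ 2 (deg-pos T f∈X e-at₂)) (subst (2 * deg T X v′ ≤_) leaf (bound v′))
    ... | s≤s ()

  deg-⊤ : ∀ {u} → StarIn T S u → deg T ⊤ u ≡ deg T S u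
  deg-⊤ star = deg-cong T (λ i _ → star i) (λ _ _ → ∈⊤)

  deg-∩-other-side : ∀ {F u} → StarIn T S′ u → deg T (F ∩ A) u ≡ 0
  deg-∩-other-side star′ = deg-zero T λ i f∈ →
    let (_ , f∈S , f≢e) = ∩A⁻ f∈ in f≢e (common-edge f∈S (star′ i))

  deg-∩ : ∀ {F u} → StarIn T S u → ¬ (e ∈ F × Incident T e u) → deg T F u ≡ deg T (F ∩ A) u
  deg-∩ star e∉ = deg-cong T
    (λ i f∈F → x∈p∩q⁺ (f∈F , A⁺ (star i) λ { refl → e∉ (f∈F , i) })) (λ _ → proj₁ ∘ ∩A⁻)

  deg-∩-suc : ∀ {F} → e ∈ F → deg T F v ≡ suc (deg T (F ∩ A) v)
  deg-∩-suc e∈F = deg-suc T e e∈F e-at₁ (λ e∈ → proj₂ (proj₂ (∩A⁻ e∈)) refl)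
    (λ i f≢e f∈F → x∈p∩q⁺ (f∈F , A⁺ (star₁ i) f≢e)) (λ _ → proj₁ ∘ ∩A⁻)

  restrict-fix : ∀ {F} → Fix T ⊤ F → Fix T S (F ∩ A)
  restrict-fix {F} (_ , bound) = proj₁ ∘ proj₂ ∘ ∩A⁻ , bound∩
    where
    bound∩ : ∀ u → 2 * deg T (F ∩ A) u ≤ deg T S u
    bound∩ u with sides u
    ... | inj₁ star = begin
      2 * deg T (F ∩ A) u ≤⟨ *-monoʳ-≤ 2 (deg-mono T (λ _ → proj₁ ∘ ∩A⁻)) ⟩
      2 * deg T F u       ≤⟨ bound u ⟩
      deg T ⊤ u           ≡⟨ deg-⊤ star ⟩
      deg T S u           ∎
      where open ≤-Reasoning
    ... | inj₂ star′ rewrite deg-∩-other-side {F} star′ = z≤n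

  restrict-fixAt : ∀ {F} → Fix T ⊤ F → e ∈ F → FixAt T S v (F ∩ A)
  restrict-fixAt {F} fix e∈F = restrict-fix fix , (begin
    2 * (deg T (F ∩ A) v + 1) ≡⟨ cong (2 *_) (+-comm _ 1) ⟩
    2 * suc (deg T (F ∩ A) v) ≡⟨ cong (2 *_) (deg-∩-suc e∈F) ⟨
    2 * deg T F v             ≤⟨ proj₂ fix v ⟩
    deg T ⊤ v                 ≡⟨ deg-⊤ star₁ ⟩
    deg T S v                 ∎)
    where open ≤-Reasoning

  bound-lift : ∀ {F u} → StarIn T S u → ¬ (e ∈ F × Incident T e u) →
    2 * deg T (F ∩ A) u ≤ deg T S u → 2 * deg T F u ≤ deg T ⊤ u
  bound-lift {F} {u} star e∉ bound = begin
    2 * deg T F u       ≡⟨ cong (2 *_) (deg-∩ star e∉) ⟩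
    2 * deg T (F ∩ A) u ≤⟨ bound ⟩
    deg T S u           ≡⟨ deg-⊤ star ⟨
    deg T ⊤ u           ∎
    where open ≤-Reasoning

  bound-lift-end : ∀ {F} → e ∈ F → 2 * (deg T (F ∩ A) v + 1) ≤ deg T S v → 2 * deg T F v ≤ deg T ⊤ v
  bound-lift-end {F} e∈F bound = begin
    2 * deg T F v             ≡⟨ cong (2 *_) (deg-∩-suc e∈F) ⟩
    2 * suc (deg T (F ∩ A) v) ≡⟨ cong (2 *_) (+-comm _ 1) ⟨
    2 * (deg T (F ∩ A) v + 1) ≤⟨ bound ⟩
    deg T S v                 ≡⟨ deg-⊤ star₁ ⟨
    deg T ⊤ v                 ∎
    where open ≤-Reasoning

module _ {n m} {T : Graph n m} {S A : Subset m} (fix⇒⊆ : ∀ {X} → Fix T S X → X ⊆ A) where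

  #subsetsOf-fix : #subsetsOf A (fix? T S) ≡ #Efix T S
  #subsetsOf-fix = count-≐ _ (fix? T S) (proj₂ , λ fix → (λ {_} → fix⇒⊆ fix) , fix) (subsets m)

  #subsetsOf-fixAt : ∀ {v} → #subsetsOf A (fixAt? T S v) ≡ #EfixAt T S v
  #subsetsOf-fixAt {v} = count-≐ _ (fixAt? T S v) (proj₂ , λ fix → (λ {_} → fix⇒⊆ (proj₁ fix)) , fix) (subsets m)

module _ {n m} {T : Graph n m} {e v₁ v₂ T₁ T₂} (split : EdgeSplit T e v₁ v₂ T₁ T₂) where

  open EdgeSplit split

  colour : Fin m → Block
  colour f with f Fin.≟ e | f ∈? T₁
  ... | yes _ | _     = middle
  ... | no _  | yes _ = left
  ... | no _  | no _  = right

  colouring : Vec Block m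
  colouring = Vec.tabulate colour

  ∈-colour⁻ : ∀ {b f} → f ∈ block b colouring → colour f ≡ b
  ∈-colour⁻ {f = f} = trans (sym (lookup∘tabulate colour f)) ∘ ∈-block⁻ colouring

  ∈-colour⁺ : ∀ {b f} → colour f ≡ b → f ∈ block b colouring
  ∈-colour⁺ {f = f} = ∈-block⁺ colouring ∘ trans (lookup∘tabulate colour f)

  A M B : Subset m
  A = block left colouring
  M = block middle colouring
  B = block right colouring

  A⁻ : ∀ {f} → f ∈ A → f ∈ T₁ × ¬ f ≡ e
  A⁻ {f} f∈ with f Fin.≟ e | f ∈? T₁ | ∈-colour⁻ {f = f} f∈
  ... | no f≢e | yes f∈T₁ | _ = f∈T₁ , f≢e

  A⁺ : ∀ {f} → f ∈ T₁ → ¬ f ≡ e → f ∈ A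
  A⁺ {f} f∈T₁ f≢e = ∈-colour⁺ is-left
    where
    is-left : colour f ≡ left
    is-left with f Fin.≟ e | f ∈? T₁
    ... | yes f≡e | _      = ⊥-elim (f≢e f≡e)
    ... | no _    | yes _  = refl
    ... | no _    | no f∉T₁ = ⊥-elim (f∉T₁ f∈T₁)

  B⁻ : ∀ {f} → f ∈ B → f ∈ T₂ × ¬ f ≡ e
  B⁻ {f} f∈ with f Fin.≟ e | f ∈? T₁ | ∈-colour⁻ {f = f} f∈
  ... | no f≢e | no f∉T₁ | _ = Sum.[ ⊥-elim ∘ f∉T₁ , (λ f∈T₂ → f∈T₂) ] (cover f) , f≢e

  B⁺ : ∀ {f} → f ∈ T₂ → ¬ f ≡ e → f ∈ B
  B⁺ {f} f∈T₂ f≢e = ∈-colour⁺ is-right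
    where
    is-right : colour f ≡ right
    is-right with f Fin.≟ e | f ∈? T₁
    ... | yes f≡e | _       = ⊥-elim (f≢e f≡e)
    ... | no _    | yes f∈T₁ = ⊥-elim (f≢e (common-edge f∈T₁ f∈T₂))
    ... | no _    | no _    = refl

  M⁻ : ∀ {f} → f ∈ M → f ≡ e
  M⁻ {f} f∈ with f Fin.≟ e | f ∈? T₁ | ∈-colour⁻ {f = f} f∈
  ... | yes f≡e | _     | _  = f≡e
  ... | no _    | yes _ | ()
  ... | no _    | no _  | ()

  e∈M : e ∈ M
  e∈M = ∈-colour⁺ is-middle
    where
    is-middle : colour e ≡ middle
    is-middle with e Fin.≟ e
    ... | yes _   = refl
    ... | no e≢e  = ⊥-elim (e≢e refl)

  private
    module S₁ = Side split A⁻ A⁺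
    module S₂ = Side swap B⁻ B⁺

  home : ∀ u → StarIn T T₁ u × (u ≡ v₁ ⊎ ¬ Incident T e u) ⊎ StarIn T T₂ u × (u ≡ v₂ ⊎ ¬ Incident T e u)
  home u with incident? T e u
  ... | yes e-at with e-ends e-at
  ...   | inj₁ refl = inj₁ (star₁ , inj₁ refl)
  ...   | inj₂ refl = inj₂ (star₂ , inj₁ refl)
  home u | no e-not-at with sides u
  ...   | inj₁ star = inj₁ (star , inj₂ e-not-at)
  ...   | inj₂ star = inj₂ (star , inj₂ e-not-at)

  fix-avoiding-e : ∀ {F} → ¬ e ∈ F → Fix T T₁ (F ∩ A) → Fix T T₂ (F ∩ B) → Fix T ⊤ F
  fix-avoiding-e {F} e∉F fix₁ fix₂ = (λ _ → ∈⊤) , bound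
    where
    bound : ∀ u → 2 * deg T F u ≤ deg T ⊤ u
    bound u with sides u
    ... | inj₁ star = S₁.bound-lift star (e∉F ∘ proj₁) (proj₂ fix₁ u)
    ... | inj₂ star = S₂.bound-lift star (e∉F ∘ proj₁) (proj₂ fix₂ u)

  fix-through-e : ∀ {F} → e ∈ F → FixAt T T₁ v₁ (F ∩ A) → FixAt T T₂ v₂ (F ∩ B) → Fix T ⊤ F
  fix-through-e {F} e∈F fix₁ fix₂ = (λ _ → ∈⊤) , bound
    where
    bound : ∀ u → 2 * deg T F u ≤ deg T ⊤ u
    bound u with home u
    ... | inj₁ (_ , inj₁ refl)       = S₁.bound-lift-end e∈F (proj₂ fix₁)
    ... | inj₁ (star , inj₂ e-not-at) = S₁.bound-lift star (e-not-at ∘ proj₂) (proj₂ (proj₁ fix₁) u)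
    ... | inj₂ (_ , inj₁ refl)       = S₂.bound-lift-end e∈F (proj₂ fix₂)
    ... | inj₂ (star , inj₂ e-not-at) = S₂.bound-lift star (e-not-at ∘ proj₂) (proj₂ (proj₁ fix₂) u)

  #subsetsOf-M-∋e : #subsetsOf M (e ∈?_) ≡ 1
  #subsetsOf-M-∋e = #subsets-unique (λ X → X ⊆? M ×-dec e ∈? X) (⊆-refl , e∈M)
    (λ (X⊆M , e∈X) → ⊆-antisym X⊆M (λ f∈M → subst (_∈ _) (sym (M⁻ f∈M)) e∈X))

  #subsetsOf-M-∌e : #subsetsOf M (¬? ∘ (e ∈?_)) ≡ 1
  #subsetsOf-M-∌e = #subsets-unique (λ X → X ⊆? M ×-dec ¬? (e ∈? X)) (⊥⊆ , ∉⊥)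
    (λ (X⊆M , e∉X) → ⊆-antisym (λ f∈X → ⊥-elim (e∉X (subst (_∈ _) (M⁻ (X⊆M f∈X)) f∈X))) ⊥⊆)

  #Efix-avoiding-e : count (λ F → fix? T ⊤ F ×-dec ¬? (e ∈? F)) (subsets m) ≡ #Efix T T₁ * #Efix T T₂
  #Efix-avoiding-e = begin
    count (λ F → fix? T ⊤ F ×-dec ¬? (e ∈? F)) (subsets m)
      ≡⟨ count-≐ _ (blockwise colouring (fix? T T₁) (¬? ∘ (e ∈?_)) (fix? T T₂))
                 (restrict , join) (subsets m) ⟩
    #subsets (blockwise colouring (fix? T T₁) (¬? ∘ (e ∈?_)) (fix? T T₂))
      ≡⟨ #subsets-blocks colouring (fix? T T₁) (¬? ∘ (e ∈?_)) (fix? T T₂) ⟩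
    #subsetsOf A (fix? T T₁) * #subsetsOf M (¬? ∘ (e ∈?_)) * #subsetsOf B (fix? T T₂)
      ≡⟨ cong₂ _*_ (cong₂ _*_ (#subsetsOf-fix S₁.fix⇒⊆) #subsetsOf-M-∌e) (#subsetsOf-fix S₂.fix⇒⊆) ⟩
    #Efix T T₁ * 1 * #Efix T T₂
      ≡⟨ cong (_* #Efix T T₂) (*-identityʳ (#Efix T T₁)) ⟩
    #Efix T T₁ * #Efix T T₂ ∎
    where
    open ≡-Reasoning
    restrict : ∀ {F} → Fix T ⊤ F × ¬ e ∈ F → Fix T T₁ (F ∩ A) × ¬ e ∈ F ∩ M × Fix T T₂ (F ∩ B)
    restrict {F} (fix , e∉F) = S₁.restrict-fix fix , e∉F ∘ proj₁ ∘ x∈p∩q⁻ F M , S₂.restrict-fix fix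
    join : ∀ {F} → Fix T T₁ (F ∩ A) × ¬ e ∈ F ∩ M × Fix T T₂ (F ∩ B) → Fix T ⊤ F × ¬ e ∈ F
    join (fix₁ , e∉F∩M , fix₂) = fix-avoiding-e e∉F fix₁ fix₂ , e∉F
      where
      e∉F = λ e∈F → e∉F∩M (x∈p∩q⁺ (e∈F , e∈M))

  #Efix-through-e : count (λ F → fix? T ⊤ F ×-dec e ∈? F) (subsets m) ≡ #EfixAt T T₁ v₁ * #EfixAt T T₂ v₂
  #Efix-through-e = begin
    count (λ F → fix? T ⊤ F ×-dec e ∈? F) (subsets m)
      ≡⟨ count-≐ _ (blockwise colouring (fixAt? T T₁ v₁) (e ∈?_) (fixAt? T T₂ v₂))
                 (restrict , join) (subsets m) ⟩
    #subsets (blockwise colouring (fixAt? T T₁ v₁) (e ∈?_) (fixAt? T T₂ v₂))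
      ≡⟨ #subsets-blocks colouring (fixAt? T T₁ v₁) (e ∈?_) (fixAt? T T₂ v₂) ⟩
    #subsetsOf A (fixAt? T T₁ v₁) * #subsetsOf M (e ∈?_) * #subsetsOf B (fixAt? T T₂ v₂)
      ≡⟨ cong₂ _*_ (cong₂ _*_ (#subsetsOf-fixAt S₁.fix⇒⊆) #subsetsOf-M-∋e) (#subsetsOf-fixAt S₂.fix⇒⊆) ⟩
    #EfixAt T T₁ v₁ * 1 * #EfixAt T T₂ v₂
      ≡⟨ cong (_* #EfixAt T T₂ v₂) (*-identityʳ (#EfixAt T T₁ v₁)) ⟩
    #EfixAt T T₁ v₁ * #EfixAt T T₂ v₂ ∎
    where
    open ≡-Reasoning
    restrict : ∀ {F} → Fix T ⊤ F × e ∈ F → FixAt T T₁ v₁ (F ∩ A) × e ∈ F ∩ M × FixAt T T₂ v₂ (F ∩ B)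
    restrict (fix , e∈F) = S₁.restrict-fixAt fix e∈F , x∈p∩q⁺ (e∈F , e∈M) , S₂.restrict-fixAt fix e∈F
    join : ∀ {F} → FixAt T T₁ v₁ (F ∩ A) × e ∈ F ∩ M × FixAt T T₂ v₂ (F ∩ B) → Fix T ⊤ F × e ∈ F
    join {F} (fix₁ , e∈F∩M , fix₂) = fix-through-e e∈F fix₁ fix₂ , e∈F
      where
      e∈F = proj₁ (x∈p∩q⁻ F M e∈F∩M)

lemma1 : ∀ {n m} (T : Graph n m) → IsTree T →
    (e : Fin m) (v₁ v₂ : Fin n) → T e ≡ (v₁ , v₂) →
    deg T ⊤ v₁ ≥ 2 → deg T ⊤ v₂ ≥ 2 →
    (T₁ T₂ : Subset m) → IsConstituent T e v₁ T₁ → IsConstituent T e v₂ T₂ →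
    #Efix T ⊤ ≡ #EfixAt T T₁ v₁ * #EfixAt T T₂ v₂ + #Efix T T₁ * #Efix T T₂
lemma1 {m = m} T tree e v₁ v₂ Te _ _ T₁ T₂ C₁ C₂ = begin
  #Efix T ⊤
    ≡⟨ count-split (fix? T ⊤) (e ∈?_) (subsets m) ⟩
  count (λ F → fix? T ⊤ F ×-dec e ∈? F) (subsets m) + count (λ F → fix? T ⊤ F ×-dec ¬? (e ∈? F)) (subsets m)
    ≡⟨ cong₂ _+_ (#Efix-through-e split) (#Efix-avoiding-e split) ⟩
  #EfixAt T T₁ v₁ * #EfixAt T T₂ v₂ + #Efix T T₁ * #Efix T T₂ ∎
  where
  open ≡-Reasoning
  split : EdgeSplit T e v₁ v₂ T₁ T₂
  split = constituents-split tree Te C₁ C₂
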